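{- Let $L\geq 2$ be an integer and $H=(V_H,E_H)$ a directed acyclic graph, and let $G$ be the graph constructed from $H$ as described in the context. Then $(L,G)$ is an instance of the bootstrap problem, and a feasible solution to the DVD problem for $(L,H)$ can be transformed into a feasible bootstrap solution for $(L,G)$ with at most the same cardinality, and vice versa (a feasible bootstrap solution for $(L,G)$ can be transformed into a feasible DVD solution for $(L,H)$ with at most the same cardinality).
   Context: DVD problem: for a DAG $H=(V_H,E_H)$ and integer $L\geq 2$, a feasible solution is $S\subseteq V_H$ such that every directed path in $H$ with $L$ vertices contains a vertex of $S$. Bootstrap problem: input a positive integer $L$ and a DAG $G=(V,E)$ (parallel edges allowed) with every vertex of indegree $0$ (white) or $2$ (blue or red). For $S\subseteq V$, define $\ell(v)=0$ if $v$ white, $\ell(v)=\max_{(u,v)\in E}\ell(u)\mathbb{1}_{V\setminus S}(u)$ if $v$ blue, $\ell(v)=\max_{(u,v)\in E}\ell(u)\mathbb{1}_{V\setminus S}(u)+1$ if $v$ red; $S$ is feasible if $\max_u\ell(u)\leq L$. Construction of $G$ from $H$: the vertex set contains $V_H$, a clone set $V_H'=\{v':v\in V_H\}$, and a new vertex $s_0$; vertices of $V_H\cup V_H'$ are red and $s_0$ is white. For every $v\in V_H$ add two copies of the edge $(v,v')$. For every $v\in V_H$ with indegree at most $2$ in $H$, keep the edges of $E_H$ entering $v$ and add $(2-\mathrm{indeg}_H(v))$ copies of the edge $(s_0,v)$. For every $v\in V_H$ with indegree $d\geq 3$ in $H$, with direct predecessors $v_1,\dots,v_d$, do not keep the edges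 $(v_i,v)$; instead add new blue vertices $w_1^{(v)},\dots,w_d^{(v)}$ and the edges: two copies of $(v_1,w_1^{(v)})$; for $i=2,\dots,d$, an edge $(w_{i-1}^{(v)},w_i^{(v)})$ and an edge $(v_i,w_i^{(v)})$; and two copies of $(w_d^{(v)},v)$. -}

module Defs where

open import Data.Nat using (ℕ; zero; suc; _≤_; _<_; _∸_; _⊔_; _≤?_)
open import Data.Nat.Properties using (≤-irrelevant; <-irrelevant; n<1+n; <-trans)
import Data.Nat.Properties as ℕP
open import Data.Fin using (Fin; fromℕ<)
import Data.Fin.Properties as FinP
open import Data.List using (List; []; _∷_; _++_; _∷ʳ_; map; replicate; length; foldr; lookup)
open import Data.List.Membership.Propositional using (_∈_)
open import Data.List.Membership.DecPropositional using () renaming (_∈?_ to dec∈)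
open import Data.List.Relation.Unary.Any using (Any)
open import Data.List.Relation.Unary.Linked using (Linked)
open import Data.List.Relation.Unary.Unique.Propositional using (Unique)
open import Data.Product using (_×_; Σ)
open import Relation.Nullary using (¬_; yes; no; does)
open import Relation.Binary.Definitions using (DecidableEquality)
open import Relation.Binary.PropositionalEquality using (_≡_; _≢_; refl)
open import Data.Bool using (if_then_else_)

-- A (multi)graph on a vertex type V is given by
-- the list of in-neighbours of every vertex ("inE v"), with multiplicity
-- (parallel edges = repeated entries).

Edge : {V : Set} → (V → List V) → V → V → Set
Edge inE u v = u ∈ inE v

Acyclic : {V : Set} → (V → V → Set) → Set
Acyclic {V} E = (v : V) (xs : List V) → ¬ Linked E (v ∷ xs ∷ʳ v)

-- a directed path: consecutive vertices joined by edges, vertices distinct;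
-- its number of vertices is 'length xs'
IsPath : {V : Set} → (V → V → Set) → List V → Set
IsPath E xs = Linked E xs × Unique xs

Finite : Set → Set
Finite V = Σ (List V) (λ vs → (v : V) → v ∈ vs)

-- DVD problem.  H has vertex set Fin n; predH v lists the direct
-- predecessors of v (in a fixed order v₁,…,v_d).  A solution S ⊆ V_H is a
-- duplicate-free list; |S| = length S.

DVDFeasible : (n : ℕ) → (Fin n → List (Fin n)) → ℕ → List (Fin n) → Set
DVDFeasible n predH L S =
  (xs : List (Fin n)) → IsPath (Edge predH) xs → length xs ≡ L → Any (_∈ S) xs

data Colour : Set where
  white blue red : Colour

maxList : List ℕ → ℕ
maxList = foldr _⊔_ 0

module Bootstrap {V : Set} (_≟_ : DecidableEquality V)
                 (colour : V → Colour) (inE : V → List V) where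

  IsInstance : Set
  IsInstance = Finite V × Acyclic (Edge inE)
             × ((v : V) → (colour v ≡ white → inE v ≡ [])
                        × (colour v ≢ white → length (inE v) ≡ 2))

  contrib : List V → (V → ℕ) → V → ℕ
  contrib S ℓ u = if does (dec∈ _≟_ u S) then 0 else ℓ u

  labelRule : Colour → ℕ → ℕ
  labelRule white m = 0
  labelRule blue  m = m
  labelRule red   m = suc m

  -- ℓ satisfies the recursive defining equations of the labelling for S
  -- (on a DAG there is exactly one such ℓ)
  IsLabelling : List V → (V → ℕ) → Set
  IsLabelling S ℓ = (v : V) →
    ℓ v ≡ labelRule (colour v) (maxList (map (contrib S ℓ) (inE v)))

  Feasible : ℕ → List V → Set
  Feasible L S = (ℓ : V → ℕ) → IsLabelling S ℓ → (u : V) → ℓ u ≤ L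

pred< : ∀ {d} → 3 ≤ d → d ∸ 1 < d
pred< {suc k} _ = n<1+n k

module Construction (n : ℕ) (predH : Fin n → List (Fin n)) where

  indeg : Fin n → ℕ
  indeg v = length (predH v)

  data GV : Set where
    orig  : Fin n → GV
    clone : Fin n → GV
    s0    : GV
    -- w^{(v)}_{i+1} (0-based index i), only for v with indegree ≥ 3
    w     : (v : Fin n) → 3 ≤ indeg v → (i : ℕ) → i < indeg v → GV

  colour : GV → Colour
  colour (orig _)    = red
  colour (clone _)   = red
  colour s0          = white
  colour (w _ _ _ _) = blue

  predAt : (v : Fin n) (i : ℕ) → i < indeg v → Fin n
  predAt v i lt = lookup (predH v) (fromℕ< lt)

  inE : GV → List GV
  inE s0 = []
  inE (clone v) = orig v ∷ orig v ∷ []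
  inE (orig v) with 3 ≤? indeg v
  ... | yes p = w v p (indeg v ∸ 1) (pred< p) ∷ w v p (indeg v ∸ 1) (pred< p) ∷ []
  ... | no _  = map orig (predH v) ++ replicate (2 ∸ indeg v) s0
  inE (w v p zero lt) = orig (predAt v zero lt) ∷ orig (predAt v zero lt) ∷ []
  inE (w v p (suc i) lt) =
    w v p i (<-trans (n<1+n i) lt) ∷ orig (predAt v (suc i) lt) ∷ []

  _≟_ : DecidableEquality GV
  orig x ≟ orig y with x FinP.≟ y
  ... | yes refl = yes refl
  ... | no ne = no λ { refl → ne refl }
  orig _ ≟ clone _ = no λ ()
  orig _ ≟ s0 = no λ ()
  orig _ ≟ w _ _ _ _ = no λ ()
  clone _ ≟ orig _ = no λ ()
  clone x ≟ clone y with x FinP.≟ y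
  ... | yes refl = yes refl
  ... | no ne = no λ { refl → ne refl }
  clone _ ≟ s0 = no λ ()
  clone _ ≟ w _ _ _ _ = no λ ()
  s0 ≟ orig _ = no λ ()
  s0 ≟ clone _ = no λ ()
  s0 ≟ s0 = yes refl
  s0 ≟ w _ _ _ _ = no λ ()
  w _ _ _ _ ≟ orig _ = no λ ()
  w _ _ _ _ ≟ clone _ = no λ ()
  w _ _ _ _ ≟ s0 = no λ ()
  w v p i lt ≟ w v' p' i' lt' with v FinP.≟ v' | i ℕP.≟ i'
  ... | no ne | _ = no λ { refl → ne refl }
  ... | yes refl | no ne = no λ { refl → ne refl }
  ... | yes refl | yes refl with ≤-irrelevant p p' | <-irrelevant lt lt'
  ... | refl | refl = yes refl

  open Bootstrap _≟_ colour inE public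

-- On the copy of H, labels count vertices of S-avoiding paths: a red vertex gets one more than
-- the largest label of an in-neighbour outside S, and the blue chain w₁ … w_d just passes the
-- largest label among v₁ … v_d on to v. So along a path of H avoiding the solution the labels
-- strictly increase, and the clone of its last vertex adds one more; conversely a label above 1
-- on v comes from a predecessor of v, outside the solution, whose label is one less. Hence a DVD
-- solution S gives the bootstrap solution {v : v ∈ S}, and a bootstrap solution S′ gives the set
-- of vertices of H hosting a member of S′ (v hosts itself and its w⁽ᵛ⁾ᵢ). G is acyclic since a
-- weighted height on H yields a rank on G, and labellings exist since a local recursion on a
-- finite acyclic graph stabilises.
module Submission where

open import Defs
open import Data.Nat using (ℕ; zero; suc; _≤_; _<_; _+_; _∸_; z≤n; s≤s; _≤?_)
open import Data.Nat.Properties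
  using (≤-reflexive; ≤-trans; ≤-<-trans; +-suc; +-monoʳ-≤; m≤m⊔n; m≤n⊔m; ⊔-sel)
import Data.Nat.Properties as ℕP
open import Data.Fin using (Fin; zero; suc; toℕ; fromℕ<)
import Data.Fin.Properties as FinP
open import Data.List
  using (List; []; _∷_; _++_; _∷ʳ_; map; length; lookup; allFin; tabulate; concatMap; replicate;
         mapMaybe; deduplicate)
open import Data.List.Properties
  using (map-cong-local; length-++; length-map; length-replicate; length-mapMaybe; length-deduplicate)
open import Data.List.Membership.Propositional using (_∈_; _∉_; find; lose)
open import Data.List.Membership.Propositional.Properties
  using (∈-lookup; ∈-map⁺; ∈-map⁻; ∈-++⁺ˡ; ∈-++⁻; ∈-allFin; ∈-tabulate⁺; ∈-concatMap⁺; ∈-deduplicate⁺)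
open import Data.List.Membership.Setoid.Properties using (index-injective)
open import Data.List.Membership.DecPropositional using () renaming (_∈?_ to dec∈)
open import Data.List.Relation.Unary.Any using (Any; here; there; index; any?)
import Data.List.Relation.Unary.Any as Any
import Data.List.Relation.Unary.Any.Properties as AnyP
import Data.Maybe.Relation.Unary.Any as MaybeAny
open import Data.Maybe using (Maybe; just; nothing)
open import Data.List.Relation.Unary.All using (All; []; _∷_; all?)
import Data.List.Relation.Unary.All as All
open import Data.List.Relation.Unary.All.Properties using (¬All⇒Any¬; All¬⇒¬Any; ¬Any⇒All¬; replicate⁺)
open import Data.List.Relation.Unary.AllPairs using ([]; _∷_)
open import Data.List.Relation.Unary.Linked using (Linked; []; [-]; _∷_)
import Data.List.Relation.Unary.Linked as Linked
open import Data.List.Relation.Unary.Unique.Propositional using (Unique)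
import Data.List.Relation.Unary.Unique.Propositional.Properties as UniqueP
open import Data.List.Relation.Unary.Unique.DecPropositional.Properties using (deduplicate-!)
open import Data.Product using (_×_; Σ; _,_; proj₁; proj₂)
open import Data.Sum using (_⊎_; inj₁; inj₂)
open import Data.Empty using (⊥; ⊥-elim)
open import Data.Unit using (⊤)
open import Relation.Nullary using (¬_; yes; no)
open import Function using (_∘_)
open import Relation.Binary.Definitions using (DecidableEquality)
open import Relation.Binary.PropositionalEquality
  using (_≡_; _≢_; refl; sym; trans; cong; cong₂; subst; setoid; module ≡-Reasoning)

module _ {V : Set} {E : V → V → Set} where

  walk-to-member : ∀ {x y xs} → Linked E (x ∷ xs) → y ∈ xs →
                   Σ (List V) λ cs → Linked E (x ∷ cs ∷ʳ y)
  walk-to-member (e ∷ _) (here refl) = [] , e ∷ [-]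
  walk-to-member (e ∷ l) (there y∈) with walk-to-member l y∈
  ... | cs , l′ = _ ∷ cs , e ∷ l′

  acyclic-walk⇒unique : Acyclic E → ∀ {xs} → Linked E xs → Unique xs
  acyclic-walk⇒unique acyc {[]} _ = []
  acyclic-walk⇒unique acyc {x ∷ xs} l =
    All.tabulate (λ y∈ → λ { refl → let cs , cycle = walk-to-member l y∈ in acyc x cs cycle })
    ∷ acyclic-walk⇒unique acyc (Linked.tail l)

  -- Walks are grown at the front, onto an accumulator, to avoid reasoning about _∷ʳ_.
  module _ (P : V → Set) (Q : ℕ → V → Set) (Q⇒P : ∀ {k v} → Q k v → P v)
           (retreat : ∀ {k v} → Q (suc k) v → Σ V λ u → E u v × Q k u) where

    private
      extend : ∀ k {v acc} → Q k v → Linked E (v ∷ acc) → All P acc →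
               Σ (List V) λ ws → Linked E ws × All P ws × length ws ≡ k + suc (length acc)
      extend zero    q l ps = _ , l , Q⇒P q ∷ ps , refl
      extend (suc k) {v} {acc} q l ps with retreat q
      ... | u , e , q′ with extend k q′ (e ∷ l) (Q⇒P q ∷ ps)
      ...   | ws , l′ , ps′ , len = ws , l′ , ps′ , trans len (+-suc k (suc (length acc)))

    walk-into : ∀ k {v} → Q k v → Σ (List V) λ ws → Linked E ws × All P ws × length ws ≡ suc k
    walk-into k q with extend k q [-] []
    ... | ws , l , ps , len = ws , l , ps , trans len (ℕP.+-comm k 1)

  rank-climbs : {P : V → Set} (g : V → ℕ) → (∀ {a b} → E a b → P a → P b → g a < g b) →
                ∀ {x xs} → Linked E (x ∷ xs) → All P (x ∷ xs) →
                Σ V λ z → P z × g x + length xs ≤ g z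
  rank-climbs g mono {x} {[]} _ (px ∷ []) = x , px , ≤-reflexive (ℕP.+-identityʳ (g x))
  rank-climbs g mono {x} {y ∷ ys} (e ∷ l) (px ∷ ps) with rank-climbs g mono l ps
  ... | z , pz , le = z , pz , (begin
    g x + suc (length ys) ≡⟨ +-suc (g x) (length ys) ⟩
    suc (g x) + length ys ≤⟨ ℕP.+-monoˡ-≤ (length ys) (mono e px (All.head ps)) ⟩
    g y + length ys       ≤⟨ le ⟩
    g z                   ∎)
    where open ℕP.≤-Reasoning

  rank⇒acyclic : (g : V → ℕ) → (∀ {a b} → E a b → g a < g b) → Acyclic E
  rank⇒acyclic g mono v xs cycle = ℕP.<-irrefl refl (climb xs cycle)
    where
      climb : ∀ {a b} xs → Linked E (a ∷ xs ∷ʳ b) → g a < g b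
      climb []       (e ∷ [-]) = mono e
      climb (x ∷ xs) (e ∷ l)   = ℕP.<-trans (mono e) (climb xs l)

unique⇒lookup-injective : {A : Set} {xs : List A} → Unique xs →
                          ∀ {i j} → lookup xs i ≡ lookup xs j → i ≡ j
unique⇒lookup-injective (_ ∷ _)  {zero}  {zero}  _  = refl
unique⇒lookup-injective (x∉ ∷ _) {zero}  {suc j} eq = ⊥-elim (All.lookup x∉ (∈-lookup j) eq)
unique⇒lookup-injective (x∉ ∷ _) {suc i} {zero}  eq = ⊥-elim (All.lookup x∉ (∈-lookup i) (sym eq))
unique⇒lookup-injective (_ ∷ u)  {suc i} {suc j} eq = cong suc (unique⇒lookup-injective u eq)

unique-length≤ : {V : Set} ((vs , _) : Finite V) → ∀ {xs} → Unique xs → length xs ≤ length vs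
unique-length≤ {V} (vs , cover) {xs} u = FinP.injective⇒≤ {f = λ i → index (cover (lookup xs i))}
  λ eq → unique⇒lookup-injective u (index-injective (setoid V) (cover _) (cover _) eq)

≤-maxList : ∀ {x xs} → x ∈ xs → x ≤ maxList xs
≤-maxList {xs = x ∷ xs} (here refl) = m≤m⊔n x (maxList xs)
≤-maxList {xs = y ∷ xs} (there x∈) = ≤-trans (≤-maxList x∈) (m≤n⊔m y (maxList xs))

maxList-witness : ∀ {t xs} → suc t ≤ maxList xs → Any (suc t ≤_) xs
maxList-witness {xs = x ∷ xs} le with ⊔-sel x (maxList xs)
... | inj₁ eq = here (subst (_ ≤_) eq le)
... | inj₂ eq = there (maxList-witness (subst (_ ≤_) eq le))

-- Iterating from 0, a change at stage k+1 propagates back along a walk with k+1 vertices,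
-- so the iteration is stable after as many rounds as there are vertices.
module Recursion {V : Set} (inE : V → List V) (Φ : V → (V → ℕ) → ℕ)
  (Φ-local : ∀ v {f g} → (∀ {u} → u ∈ inE v → f u ≡ g u) → Φ v f ≡ Φ v g) where

  iterate : ℕ → V → ℕ
  iterate zero    _ = 0
  iterate (suc k) v = Φ v (iterate k)

  Changes : ℕ → V → Set
  Changes k v = iterate (suc k) v ≢ iterate k v

  change-retreats : ∀ {k v} → Changes (suc k) v → Σ V λ u → u ∈ inE v × Changes k u
  change-retreats {k} {v} ch with all? (λ u → iterate (suc k) u ℕP.≟ iterate k u) (inE v)
  ... | yes same = ⊥-elim (ch (Φ-local v (All.lookup same)))
  ... | no ¬same = find (¬All⇒Any¬ (λ u → _ ℕP.≟ _) (inE v) ¬same)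

  solution : Finite V → Acyclic (Edge inE) → Σ (V → ℕ) λ f → ∀ v → f v ≡ Φ v f
  solution fin acyc = iterate N , stable
    where
      N = length (proj₁ fin)
      stable : ∀ v → iterate N v ≡ iterate (suc N) v
      stable v with iterate (suc N) v ℕP.≟ iterate N v
      ... | yes eq = sym eq
      ... | no ch with walk-into (λ _ → ⊤) Changes _ (λ {k} → change-retreats {k}) N ch
      ...   | ws , walk , _ , len =
        ⊥-elim (ℕP.<-irrefl refl (subst (_≤ N) len (unique-length≤ fin (acyclic-walk⇒unique acyc walk))))

module BootstrapProperties {V : Set} (_≟_ : DecidableEquality V)
                      (colour : V → Colour) (inE : V → List V) where
  open Bootstrap _≟_ colour inE

  inMax : List V → (V → ℕ) → V → ℕ
  inMax S ℓ v = maxList (map (contrib S ℓ) (inE v))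

  contrib-∉ : ∀ {S ℓ u} → u ∉ S → contrib S ℓ u ≡ ℓ u
  contrib-∉ {S} {ℓ} {u} u∉ with dec∈ _≟_ u S
  ... | yes u∈ = ⊥-elim (u∉ u∈)
  ... | no _   = refl

  contrib-positive : ∀ {S ℓ u t} → suc t ≤ contrib S ℓ u → u ∉ S × suc t ≤ ℓ u
  contrib-positive {S} {ℓ} {u} le with dec∈ _≟_ u S
  ... | no u∉ = u∉ , le

  in≤inMax : ∀ {S ℓ u v} → u ∈ inE v → u ∉ S → ℓ u ≤ inMax S ℓ v
  in≤inMax {S} {ℓ} u∈ u∉ =
    subst (_≤ inMax S ℓ _) (contrib-∉ {S} {ℓ} u∉) (≤-maxList (∈-map⁺ (contrib S ℓ) u∈))

  inMax-witness : ∀ {S ℓ v t} → suc t ≤ inMax S ℓ v →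
                  Σ V λ u → u ∈ inE v × u ∉ S × suc t ≤ ℓ u
  inMax-witness {S} {ℓ} {v} le with find (maxList-witness le)
  ... | c , c∈ , le′ with ∈-map⁻ (contrib S ℓ) c∈
  ...   | u , u∈ , refl = u , u∈ , contrib-positive {S} {ℓ} le′

  labelling-exists : Finite V → Acyclic (Edge inE) → (S : List V) → Σ (V → ℕ) (IsLabelling S)
  labelling-exists fin acyc S = Recursion.solution inE rule rule-local fin acyc
    where
      rule : V → (V → ℕ) → ℕ
      rule v ℓ = labelRule (colour v) (inMax S ℓ v)
      rule-local : ∀ v {f g} → (∀ {u} → u ∈ inE v → f u ≡ g u) → rule v f ≡ rule v g
      rule-local v eq = cong (labelRule (colour v) ∘ maxList) (map-cong-local (All.tabulate λ {u} u∈ →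
        cong (λ t → contrib S (λ _ → t) u) (eq u∈)))

  module Labelling {S : List V} {ℓ : V → ℕ} (lab : IsLabelling S ℓ) where

    white-zero : ∀ {v} → colour v ≡ white → ℓ v ≡ 0
    white-zero {v} c = trans (lab v) (cong (λ c → labelRule c (inMax S ℓ v)) c)

    red-label : ∀ {v} → colour v ≡ red → ℓ v ≡ suc (inMax S ℓ v)
    red-label {v} c = trans (lab v) (cong (λ c → labelRule c (inMax S ℓ v)) c)

    blue-label : ∀ {v} → colour v ≡ blue → ℓ v ≡ inMax S ℓ v
    blue-label {v} c = trans (lab v) (cong (λ c → labelRule c (inMax S ℓ v)) c)

    red-positive : ∀ {v} → colour v ≡ red → 0 < ℓ v
    red-positive c = subst (0 <_) (sym (red-label c)) (s≤s z≤n)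

    red-in< : ∀ {u v} → colour v ≡ red → u ∈ inE v → u ∉ S → ℓ u < ℓ v
    red-in< {u} c u∈ u∉ = subst (ℓ u <_) (sym (red-label c)) (s≤s (in≤inMax {S} {ℓ} u∈ u∉))

    blue-in≤ : ∀ {u v} → colour v ≡ blue → u ∈ inE v → u ∉ S → ℓ u ≤ ℓ v
    blue-in≤ {u} c u∈ u∉ = subst (ℓ u ≤_) (sym (blue-label c)) (in≤inMax {S} {ℓ} u∈ u∉)

    red-witness : ∀ {v t} → colour v ≡ red → suc (suc t) ≤ ℓ v →
                  Σ V λ u → u ∈ inE v × u ∉ S × suc t ≤ ℓ u
    red-witness c le = inMax-witness {S} {ℓ} (ℕP.≤-pred (subst (_ ≤_) (red-label c) le))

    blue-witness : ∀ {v t} → colour v ≡ blue → suc t ≤ ℓ v →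
                   Σ V λ u → u ∈ inE v × u ∉ S × suc t ≤ ℓ u
    blue-witness c le = inMax-witness {S} {ℓ} (subst (_ ≤_) (blue-label c) le)

module _ (n : ℕ) (predH : Fin n → List (Fin n)) where
  open Construction n predH
  open BootstrapProperties _≟_ colour inE

  w-≡ : ∀ {v p p′ i j lt lt′} → i ≡ j → w v p i lt ≡ w v p′ j lt′
  w-≡ {v} {p} {p′} {i} {lt = lt} {lt′} refl =
    cong₂ (λ q r → w v q i r) (ℕP.≤-irrelevant p p′) (ℕP.<-irrelevant lt lt′)

  wLast : (v : Fin n) → 3 ≤ indeg v → GV
  wLast v p = w v p (indeg v ∸ 1) (pred< p)

  inE-orig-split : ∀ {z u} → u ∈ inE (orig z) →
    (Σ (Fin n) λ y → y ∈ predH z × u ≡ orig y) ⊎ (u ≡ s0 ⊎ Σ (3 ≤ indeg z) λ p → u ≡ wLast z p)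
  inE-orig-split {z} u∈ with 3 ≤? indeg z
  ... | yes p with u∈
  ...   | here eq         = inj₂ (inj₂ (p , eq))
  ...   | there (here eq) = inj₂ (inj₂ (p , eq))
  inE-orig-split {z} u∈ | no _ with ∈-++⁻ (map orig (predH z)) u∈
  ...   | inj₁ u∈orig with ∈-map⁻ orig u∈orig
  ...     | y , y∈ , eq = inj₁ (y , y∈ , eq)
  inE-orig-split {z} u∈ | no _ | inj₂ u∈s0 = inj₂ (inj₁ (All.lookup (replicate⁺ {P = _≡ s0} _ refl) u∈s0))

  orig∈inE-orig : ∀ {y z} → ¬ 3 ≤ indeg z → y ∈ predH z → orig y ∈ inE (orig z)
  orig∈inE-orig {z = z} small y∈ with 3 ≤? indeg z
  ... | yes p = ⊥-elim (small p)
  ... | no _  = ∈-++⁺ˡ (∈-map⁺ orig y∈)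

  wLast∈inE-orig : ∀ {z} p → wLast z p ∈ inE (orig z)
  wLast∈inE-orig {z} p with 3 ≤? indeg z
  ... | yes q = here (w-≡ refl)
  ... | no large = ⊥-elim (large p)

  predAt∈inE-w : ∀ {z p} i lt → orig (predAt z i lt) ∈ inE (w z p i lt)
  predAt∈inE-w zero    _ = here refl
  predAt∈inE-w (suc i) _ = there (here refl)

  predAt∈predH : ∀ {z} i lt → predAt z i lt ∈ predH z
  predAt∈predH {z} i lt = ∈-lookup (fromℕ< lt)

  predAt-index : ∀ {y z} → y ∈ predH z → Σ ℕ λ i → Σ (i < indeg z) λ lt → predAt z i lt ≡ y
  predAt-index {z = z} y∈ = toℕ (index y∈) , FinP.toℕ<n _ ,
    trans (cong (lookup (predH z)) (FinP.fromℕ<-toℕ _ _)) (sym (AnyP.lookup-index y∈))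

  chainVertex : ∀ {v} → 3 ≤ indeg v → Fin (indeg v) → GV
  chainVertex {v} p i = w v p (toℕ i) (FinP.toℕ<n i)

  chain : Fin n → List GV
  chain v with 3 ≤? indeg v
  ... | yes p = tabulate (chainVertex p)
  ... | no _  = []

  w∈chain : ∀ {v} p i lt → w v p i lt ∈ chain v
  w∈chain {v} p i lt with 3 ≤? indeg v
  ... | yes q = subst (_∈ tabulate (chainVertex q)) (w-≡ (FinP.toℕ-fromℕ< lt)) (∈-tabulate⁺ (fromℕ< lt))
  ... | no large = ⊥-elim (large p)

  G-finite : Finite GV
  G-finite = s0 ∷ concatMap block (allFin n) , λ
    { s0           → here refl
    ; (orig v)     → there (in-block v (here refl))
    ; (clone v)    → there (in-block v (there (here refl)))
    ; (w v p i lt) → there (in-block v (there (there (w∈chain p i lt)))) }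
    where
      block : Fin n → List GV
      block v = orig v ∷ clone v ∷ chain v
      in-block : ∀ {u} v → u ∈ block v → u ∈ concatMap block (allFin n)
      in-block v u∈ = ∈-concatMap⁺ block (lose (∈-allFin v) u∈)

  indeg-orig : ∀ v → length (inE (orig v)) ≡ 2
  indeg-orig v with 3 ≤? indeg v
  ... | yes _ = refl
  ... | no large = begin
    length (map orig (predH v) ++ replicate (2 ∸ indeg v) s0)  ≡⟨ length-++ (map orig (predH v)) ⟩
    length (map orig (predH v)) + length (replicate (2 ∸ indeg v) s0)
      ≡⟨ cong₂ _+_ (length-map orig (predH v)) (length-replicate (2 ∸ indeg v)) ⟩
    indeg v + (2 ∸ indeg v)                                     ≡⟨ ℕP.m+[n∸m]≡n (ℕP.≤-pred (ℕP.≰⇒> large)) ⟩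
    2                                                           ∎
    where open ≡-Reasoning

  G-degrees : (v : GV) → (colour v ≡ white → inE v ≡ []) × (colour v ≢ white → length (inE v) ≡ 2)
  G-degrees s0               = (λ _ → refl) , λ nonwhite → ⊥-elim (nonwhite refl)
  G-degrees (orig v)         = (λ ()) , λ _ → indeg-orig v
  G-degrees (clone v)        = (λ ()) , λ _ → refl
  G-degrees (w v p zero lt)  = (λ ()) , λ _ → refl
  G-degrees (w v p (suc i) lt) = (λ ()) , λ _ → refl

  module Labelled (S′ : List GV) (ℓ : GV → ℕ) (lab : IsLabelling S′ ℓ) where
    open Labelling {S′} {ℓ} lab public

    s0-zero : ℓ s0 ≡ 0
    s0-zero = white-zero refl

    HighPred : Fin n → ℕ → Set
    HighPred x t = Σ (Fin n) λ y → y ∈ predH x × orig y ∉ S′ × suc t ≤ ℓ (orig y)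

    w-descend : ∀ {z p} i lt {t} → suc t ≤ ℓ (w z p i lt) → HighPred z t
    w-descend i lt le with blue-witness refl le
    w-descend zero    lt le | _ , here refl         , u∉ , le′ = _ , predAt∈predH zero lt , u∉ , le′
    w-descend zero    lt le | _ , there (here refl) , u∉ , le′ = _ , predAt∈predH zero lt , u∉ , le′
    w-descend (suc i) lt le | _ , here refl         , u∉ , le′ = w-descend i _ le′
    w-descend (suc i) lt le | _ , there (here refl) , u∉ , le′ = _ , predAt∈predH (suc i) lt , u∉ , le′

    orig-descend : ∀ {x t} → suc (suc t) ≤ ℓ (orig x) → HighPred x t
    orig-descend le with red-witness refl le
    ... | u , u∈ , u∉ , le′ with inE-orig-split u∈
    ...   | inj₁ (y , y∈ , refl)   = y , y∈ , u∉ , le′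
    ...   | inj₂ (inj₁ refl)       = ⊥-elim (ℕP.<⇒≱ (s≤s z≤n) (subst (_ ≤_) s0-zero le′))
    ...   | inj₂ (inj₂ (p , refl)) = w-descend _ _ le′

    w-mono : ∀ {z p i j} (lt : i < indeg z) (lt′ : j < indeg z) → (∀ {k lt″} → w z p k lt″ ∉ S′) →
             i ≤ j → ℓ (w z p i lt) ≤ ℓ (w z p j lt′)
    w-mono {j = zero}  lt lt′ w∉ z≤n = ≤-reflexive (cong ℓ (w-≡ refl))
    w-mono {i = i} {suc j} lt lt′ w∉ i≤ with ℕP.m≤n⇒m<n∨m≡n i≤
    ... | inj₂ refl = ≤-reflexive (cong ℓ (w-≡ refl))
    ... | inj₁ i<   = ≤-trans (w-mono lt _ w∉ (ℕP.≤-pred i<)) (blue-in≤ refl (here refl) w∉)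

    pred-climbs : ∀ {y z} → y ∈ predH z → orig y ∉ S′ → (∀ {p k lt} → w z p k lt ∉ S′) →
                  ℓ (orig y) < ℓ (orig z)
    pred-climbs {y} {z} y∈ y∉ w∉ with 3 ≤? indeg z
    ... | no small = red-in< refl (orig∈inE-orig small y∈) y∉
    ... | yes p with predAt-index y∈
    ...   | i , lt , refl = begin-strict
      ℓ (orig (predAt z i lt))            ≤⟨ blue-in≤ refl (predAt∈inE-w i lt) y∉ ⟩
      ℓ (w z p i lt)                      ≤⟨ w-mono lt (pred< p) w∉ (ℕP.∸-monoˡ-≤ 1 lt) ⟩
      ℓ (wLast z p)                       <⟨ red-in< refl (wLast∈inE-orig p) w∉ ⟩
      ℓ (orig z)                          ∎
      where open ℕP.≤-Reasoning

  host : GV → Maybe (Fin n)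
  host (orig x)    = just x
  host (w v _ _ _) = just v
  host (clone _)   = nothing
  host s0          = nothing

  hosts : List GV → List (Fin n)
  hosts S′ = deduplicate FinP._≟_ (mapMaybe host S′)

  hosts-length : ∀ S′ → length (hosts S′) ≤ length S′
  hosts-length S′ = ≤-trans (length-deduplicate FinP._≟_ (mapMaybe host S′)) (length-mapMaybe host S′)

  hosts-unique : ∀ S′ → Unique (hosts S′)
  hosts-unique S′ = deduplicate-! FinP._≟_ (mapMaybe host S′)

  ∈-hosts : ∀ {S′ u x} → u ∈ S′ → host u ≡ just x → x ∈ hosts S′
  ∈-hosts {u = u} {x} u∈ eq = ∈-deduplicate⁺ FinP._≟_
    (AnyP.mapMaybe⁺ host _ (AnyP.map⁺ (Any.map hosted u∈)))
    where
      hosted : ∀ {u′} → u ≡ u′ → MaybeAny.Any (x ≡_) (host u′)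
      hosted refl = subst (MaybeAny.Any (x ≡_)) (sym eq) (MaybeAny.just refl)

  -- The weight indeg v in the height leaves room for the chain w₁ … w_d between the
  -- predecessors of v and v.
  height : Acyclic (Edge predH) →
           Σ (Fin n → ℕ) λ r → ∀ v → r v ≡ suc (indeg v + maxList (map r (predH v)))
  height = Recursion.solution predH (λ v r → suc (indeg v + maxList (map r (predH v))))
    (λ v eq → cong (λ t → suc (indeg v + maxList t)) (map-cong-local (All.tabulate eq)))
    (allFin n , ∈-allFin)

  module _ (acyc : Acyclic (Edge predH)) where

    private
      r : Fin n → ℕ
      r = proj₁ (height acyc)

      predMax : Fin n → ℕ
      predMax v = maxList (map r (predH v))

      pred≤predMax : ∀ {y z} → y ∈ predH z → r y ≤ predMax z
      pred≤predMax y∈ = ≤-maxList (∈-map⁺ r y∈)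

      r-unfold : ∀ v → r v ≡ suc (indeg v + predMax v)
      r-unfold = proj₂ (height acyc)

      predMax<r : ∀ z → predMax z < r z
      predMax<r z = subst (predMax z <_) (sym (r-unfold z)) (s≤s (ℕP.m≤n+m (predMax z) (indeg z)))

      pred<w-rank : ∀ {y z} i → y ∈ predH z → r y < suc (predMax z + i)
      pred<w-rank i y∈ = s≤s (≤-trans (pred≤predMax y∈) (ℕP.m≤m+n _ i))

      w-rank<r : ∀ {z} i → i < indeg z → suc (predMax z + i) < r z
      w-rank<r {z} i i< = begin-strict
        suc (predMax z + i)       ≡⟨ sym (+-suc (predMax z) i) ⟩
        predMax z + suc i         ≤⟨ +-monoʳ-≤ (predMax z) i< ⟩
        predMax z + indeg z       ≡⟨ ℕP.+-comm (predMax z) (indeg z) ⟩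
        indeg z + predMax z       <⟨ ℕP.n<1+n _ ⟩
        suc (indeg z + predMax z) ≡⟨ sym (r-unfold z) ⟩
        r z                       ∎
        where open ℕP.≤-Reasoning

    rank : GV → ℕ
    rank s0          = 0
    rank (orig v)    = r v
    rank (clone v)   = suc (r v)
    rank (w v _ i _) = suc (predMax v + i)

    rank-edge : ∀ {u v} → u ∈ inE v → rank u < rank v
    rank-edge {v = orig z} u∈ with inE-orig-split u∈
    ... | inj₁ (y , y∈ , refl)   = ≤-<-trans (pred≤predMax y∈) (predMax<r z)
    ... | inj₂ (inj₁ refl)       = ≤-<-trans z≤n (predMax<r z)
    ... | inj₂ (inj₂ (p , refl)) = w-rank<r (indeg z ∸ 1) (pred< p)
    rank-edge {v = clone z} (here refl)                    = ℕP.n<1+n _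
    rank-edge {v = clone z} (there (here refl))            = ℕP.n<1+n _
    rank-edge {v = w z p zero lt} (here refl)              = pred<w-rank 0 (predAt∈predH 0 lt)
    rank-edge {v = w z p zero lt} (there (here refl))      = pred<w-rank 0 (predAt∈predH 0 lt)
    rank-edge {v = w z p (suc i) lt} (here refl)           = s≤s (≤-reflexive (sym (+-suc _ i)))
    rank-edge {v = w z p (suc i) lt} (there (here refl))   = pred<w-rank (suc i) (predAt∈predH (suc i) lt)

    G-acyclic : Acyclic (Edge inE)
    G-acyclic = rank⇒acyclic rank (λ {u} {v} → rank-edge {u} {v})

    G-instance : IsInstance
    G-instance = G-finite , G-acyclic , G-degrees

    forward-feasible : ∀ L S → DVDFeasible n predH (suc L) S → Feasible (suc L) (map orig S)
    forward-feasible L S dvd ℓ lab u = ℕP.≮⇒≥ (exceeds u)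
      where
        open Labelled (map orig S) ℓ lab

        orig∉ : ∀ {y} → orig y ∉ map orig S → y ∉ S
        orig∉ o∉ y∈ = o∉ (∈-map⁺ orig y∈)

        High : ℕ → Fin n → Set
        High k x = orig x ∉ map orig S × suc k ≤ ℓ (orig x)

        retreat : ∀ {k x} → High (suc k) x → Σ (Fin n) λ y → y ∈ predH x × High k y
        retreat (_ , le) with orig-descend le
        ... | y , y∈ , y∉ , le′ = y , y∈ , y∉ , le′

        orig-bounded : ∀ {x} → orig x ∉ map orig S → ¬ suc L ≤ ℓ (orig x)
        orig-bounded x∉ le with walk-into (_∉ S) High (orig∉ ∘ proj₁) (λ {k} → retreat {k}) L (x∉ , le)
        ... | ws , walk , avoid , len =
          All¬⇒¬Any avoid (dvd ws (walk , acyclic-walk⇒unique acyc walk) len)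

        exceeds : ∀ u → ¬ suc L < ℓ u
        exceeds s0 le = ℕP.<⇒≱ (s≤s z≤n) (subst (_ ≤_) s0-zero le)
        exceeds (orig x) le with orig-descend le
        ... | _ , _ , y∉ , le′ = orig-bounded y∉ le′
        exceeds (clone x) le with red-witness refl le
        ... | _ , here refl         , x∉ , le′ = orig-bounded x∉ le′
        ... | _ , there (here refl) , x∉ , le′ = orig-bounded x∉ le′
        exceeds (w z p i lt) le with w-descend i lt le
        ... | _ , _ , y∉ , le′ = orig-bounded y∉ (ℕP.≤-trans (ℕP.n≤1+n _) le′)

    backward-feasible : ∀ L S′ → Feasible (suc L) S′ → DVDFeasible n predH (suc L) (hosts S′)
    backward-feasible L S′ feas xs (walk , _) len with any? (λ y → dec∈ FinP._≟_ y (hosts S′)) xs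
    ... | yes hit  = hit
    ... | no miss = ⊥-elim (unreachable xs walk (¬Any⇒All¬ xs miss) len)
      where
        labelled = labelling-exists G-finite G-acyclic S′
        ℓ = proj₁ labelled
        open Labelled S′ ℓ (proj₂ labelled)

        orig∉ : ∀ {y} → y ∉ hosts S′ → orig y ∉ S′
        orig∉ y∉ o∈ = y∉ (∈-hosts o∈ refl)

        climbs : ∀ {y z} → y ∈ predH z → y ∉ hosts S′ → z ∉ hosts S′ → ℓ (orig y) < ℓ (orig z)
        climbs y∈ y∉ z∉ = pred-climbs y∈ (orig∉ y∉) (λ w∈ → z∉ (∈-hosts w∈ refl))

        unreachable : ∀ xs → Linked (Edge predH) xs → All (_∉ hosts S′) xs → length xs ≡ suc L → ⊥
        unreachable (x ∷ xs) walk avoid len with rank-climbs (ℓ ∘ orig) climbs walk avoid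
        ... | z , z∉ , high = ℕP.<⇒≱ clone-high (feas ℓ (proj₂ labelled) (clone z))
          where
            open ℕP.≤-Reasoning
            clone-high : suc L < ℓ (clone z)
            clone-high = begin-strict
              suc L                   ≡⟨ sym len ⟩
              suc (length xs)         ≤⟨ ℕP.+-monoˡ-≤ (length xs) (red-positive {orig x} refl) ⟩
              ℓ (orig x) + length xs  ≤⟨ high ⟩
              ℓ (orig z)              <⟨ red-in< {v = clone z} refl (here refl) (orig∉ z∉) ⟩
              ℓ (clone z)             ∎

lemma4 : (L : ℕ) → 2 ≤ L → (n : ℕ) (predH : Fin n → List (Fin n))
    → ((v : Fin n) → Unique (predH v))
    → Acyclic (Edge predH)
    → Construction.IsInstance n predH
      × ((S : List (Fin n)) → Unique S → DVDFeasible n predH L S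
          → Σ (List (Construction.GV n predH)) (λ S′ →
              Unique S′ × Construction.Feasible n predH L S′ × length S′ ≤ length S))
      × ((S′ : List (Construction.GV n predH)) → Unique S′ → Construction.Feasible n predH L S′
          → Σ (List (Fin n)) (λ S →
              Unique S × DVDFeasible n predH L S × length S ≤ length S′))
lemma4 (suc L) (s≤s _) n predH _ acyc =
  G-instance n predH acyc ,
  (λ S S-unique dvd → map orig S , UniqueP.map⁺ orig-injective S-unique ,
     forward-feasible n predH acyc L S dvd , ≤-reflexive (length-map orig S)) ,
  (λ S′ _ feas → hosts n predH S′ , hosts-unique n predH S′ ,
     backward-feasible n predH acyc L S′ feas , hosts-length n predH S′)
  where
    open Construction n predH using (orig)
    orig-injective : ∀ {x y} → orig x ≡ orig y → x ≡ y
    orig-injective refl = refl
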